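{- $m(n,R)=\min\{m(n,R_i/M_i): i\in[\ell]\}$.
   Context: $R$ is a finite commutative ring with identity $1\neq0$, written as $R=R_1\times\cdots\times R_\ell$ with $R_i$ finite local rings with maximal ideals $M_i$, so $R_i/M_i$ are finite fields. For a commutative ring $S$, a set of vectors in $S^n$ is unimodular if the matrix having them as rows has a right inverse; an $m$-subspace of $S^n$ is a submodule with a basis of $m$ vectors forming a unimodular set; points are $1$-subspaces. A $k$-arc in $S^n$ is a set of $k$ points such that any $n$ of them span the whole space $S^n$ (arcs are assumed to have size at least $n+1$). $m(n,S)$ denotes the maximum number of points of an arc in $S^n$. -}

module Defs where

open import Level using (Level; _⊔_; suc)
open import Data.Nat using (ℕ; zero; _<_; _⊓_) renaming (suc to sucℕ)
open import Data.Fin using (Fin; _≟_) renaming (zero to fz; suc to fs)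
open import Data.List using (List)
open import Data.List.Relation.Unary.Any using (Any)
open import Data.Product using (Σ; _×_; _,_)
open import Data.Sum using (_⊎_)
open import Relation.Nullary using (¬_; yes; no)
open import Relation.Unary using (Pred; _⊆_)
open import Relation.Binary.PropositionalEquality using (_≡_; _≢_)
open import Function.Definitions using (Injective)
open import Algebra.Bundles using (CommutativeRing)
open import Algebra.Bundles.Raw using (RawRing)

module _ {c ℓ : Level} (S : RawRing c ℓ) where
  open RawRing S

  sumF : {n : ℕ} → (Fin n → Carrier) → Carrier
  sumF {zero}   f = 0#
  sumF {sucℕ n} f = f fz + sumF (λ j → f (fs j))

  δ : {m : ℕ} → Fin m → Fin m → Carrier
  δ i k with i ≟ k
  ... | yes _ = 1#
  ... | no  _ = 0#

  Unimodular : {m n : ℕ} → (Fin m → Fin n → Carrier) → Set (c ⊔ ℓ)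
  Unimodular {m} {n} V =
    Σ (Fin n → Fin m → Carrier) λ B →
      ∀ i k → sumF (λ j → V i j * B j k) ≈ δ i k

  InSpan : {m n : ℕ} → (Fin m → Fin n → Carrier) → (Fin n → Carrier) → Set (c ⊔ ℓ)
  InSpan {m} {n} V x =
    Σ (Fin m → Carrier) λ a → ∀ j → x j ≈ sumF (λ t → a t * V t j)

  SpansAll : {m n : ℕ} → (Fin m → Fin n → Carrier) → Set (c ⊔ ℓ)
  SpansAll {m} {n} V = ∀ (x : Fin n → Carrier) → InSpan V x

  -- A point (1-subspace) is the submodule S·u generated by a vector u
  -- forming a unimodular set {u}.  Two generators give the same point
  -- iff the submodules they generate coincide.
  IsPointGen : {n : ℕ} → (Fin n → Carrier) → Set (c ⊔ ℓ)
  IsPointGen u = Unimodular {m = 1} (λ _ → u)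

  SamePoint : {n : ℕ} → (Fin n → Carrier) → (Fin n → Carrier) → Set (c ⊔ ℓ)
  SamePoint u w = InSpan {m = 1} (λ _ → w) u × InSpan {m = 1} (λ _ → u) w

  IsArc : (n k : ℕ) → (Fin k → Fin n → Carrier) → Set (c ⊔ ℓ)
  IsArc n k p =
    (n < k)
    × (∀ i → IsPointGen (p i))
    × (∀ i j → i ≢ j → ¬ SamePoint (p i) (p j))
    × (∀ (σ : Fin n → Fin k) → Injective _≡_ _≡_ σ →
         SpansAll (λ t → p (σ t)))

  HasArc : (n k : ℕ) → Set (c ⊔ ℓ)
  HasArc n k = Σ (Fin k → Fin n → Carrier) λ p → IsArc n k p

  IsMaxArcSize : (n m : ℕ) → Set (c ⊔ ℓ)
  IsMaxArcSize n m = HasArc n m × (∀ k → HasArc n k → k Data.Nat.≤ m)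

module _ {c ℓ : Level} (R : CommutativeRing c ℓ) where
  open CommutativeRing R

  record IsIdeal (I : Pred Carrier ℓ) : Set (c ⊔ ℓ) where
    field
      resp  : ∀ {x y} → x ≈ y → I x → I y
      zero∈ : I 0#
      +∈    : ∀ {x y} → I x → I y → I (x + y)
      *∈    : ∀ r {x} → I x → I (r * x)

  IsMaximalIdeal : Pred Carrier ℓ → Set (c ⊔ suc ℓ)
  IsMaximalIdeal M =
    IsIdeal M × ¬ M 1# ×
    (∀ (J : Pred Carrier ℓ) → IsIdeal J → M ⊆ J → J ⊆ M ⊎ J 1#)

  IsLocalWith : Pred Carrier ℓ → Set (c ⊔ suc ℓ)
  IsLocalWith M =
    IsMaximalIdeal M ×
    (∀ (J : Pred Carrier ℓ) → IsMaximalIdeal J → J ⊆ M × M ⊆ J)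

  Finite : Set (c ⊔ ℓ)
  Finite = Σ (List Carrier) λ xs → ∀ x → Any (x ≈_) xs

  -- residue ring R/M: same carrier, equality x ≈ y iff x - y ∈ M
  residue : Pred Carrier ℓ → RawRing c ℓ
  residue M = record
    { Carrier = Carrier
    ; _≈_ = λ x y → M (x - y)
    ; _+_ = _+_
    ; _*_ = _*_
    ; -_ = -_
    ; 0# = 0#
    ; 1# = 1#
    }

prodRing : {c ℓ : Level} {l : ℕ} → (Fin l → CommutativeRing c ℓ) → RawRing c ℓ
prodRing {l = l} R = record
  { Carrier = (i : Fin l) → CommutativeRing.Carrier (R i)
  ; _≈_ = λ x y → ∀ i → CommutativeRing._≈_ (R i) (x i) (y i)
  ; _+_ = λ x y i → CommutativeRing._+_ (R i) (x i) (y i)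
  ; _*_ = λ x y i → CommutativeRing._*_ (R i) (x i) (y i)
  ; -_ = λ x i → CommutativeRing.-_ (R i) (x i)
  ; 0# = λ i → CommutativeRing.0# (R i)
  ; 1# = λ i → CommutativeRing.1# (R i)
  }

minF : {l : ℕ} → (Fin (sucℕ l) → ℕ) → ℕ
minF {zero}   f = f fz
minF {sucℕ l} f = f fz ⊓ minF (λ i → f (fs i))

-- Points, unimodularity and spans in Rⁿ are computed componentwise in R = R₁ × ⋯ × R_ℓ, so an arc
-- of size k in Rⁿ is the same as an arc of size k in every R_iⁿ. For a finite local ring R_i with
-- residue field F_i, reduction modulo M_i maps arcs of R_iⁿ to arcs of F_iⁿ: unimodularity and
-- spanning survive reduction, and two reduced points cannot coincide, since then n − 1 vectors of a
-- spanning n-family through both would span F_iⁿ. Conversely every element outside M_i is a unit,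
-- so unimodular vectors lift and, by Gaussian elimination (Nakayama), any lift of a family spanning
-- F_iⁿ spans R_iⁿ; hence arcs of F_iⁿ lift to arcs of R_iⁿ. Truncating arcs of the F_i to the common
-- size min m(n, F_i) therefore yields an arc of that size in Rⁿ, and no larger one exists.

module Submission where

open import Defs
open import Level using (Level; _⊔_)
open import Data.Nat as ℕ using (ℕ; zero; suc; _≤_; _<_; z≤n; s≤s)
import Data.Nat.Properties as ℕ
open import Data.Fin using (Fin; zero; suc; punchIn; punchOut; inject≤; _≟_)
import Data.Fin.Properties as Fin
open import Data.Integer as ℤ using (ℤ; +_; -[1+_]; _⊖_)
import Data.Integer.Properties as ℤ
open import Data.Sign as Sign using (Sign)
open import Data.List using (List; []; _∷_; length; lookup)
import Data.List.Relation.Unary.Any as Any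
open import Data.List.Relation.Unary.Any.Properties using (lookup-index)
open import Data.Maybe using (Maybe; just; nothing)
open import Data.Vec.Functional using (insertAt)
open import Data.Vec.Functional.Properties using (insertAt-lookup; insertAt-punchIn)
open import Data.Product using (Σ; _×_; _,_; proj₁; proj₂)
open import Data.Sum using (_⊎_; inj₁; inj₂)
open import Data.Empty using (⊥-elim)
open import Function.Definitions using (Injective)
open import Relation.Nullary using (¬_; Dec; yes; no)
open import Relation.Nullary.Decidable using (decidable-stable)
open import Relation.Unary using (Pred; _⊆_)
open import Relation.Binary.PropositionalEquality as ≡ using (_≡_; _≢_)
open import Algebra.Bundles using (CommutativeRing; RawRing)
import Algebra.Solver.Ring.AlmostCommutativeRing as ACR

module IntegerCoefficientSolver {c ℓ : Level} (R : CommutativeRing c ℓ) where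
  open CommutativeRing R
  open import Algebra.Properties.Ring ring using (-‿distribˡ-*; -‿distribʳ-*; -‿involutive; -0#≈0#)
  open import Algebra.Properties.AbelianGroup +-abelianGroup using (⁻¹-∙-comm)
  open import Algebra.Properties.Semiring.Mult.TCOptimised semiring
    using (×-homo-+; ×1-homo-*; 1+×) renaming (_×_ to _·_)
  open import Relation.Binary.Reasoning.Setoid setoid

  ⟦_⟧ℤ : ℤ → Carrier
  ⟦ + n ⟧ℤ    = n · 1#
  ⟦ -[1+ n ] ⟧ℤ = - (suc n · 1#)

  private
    signed : Sign → Carrier → Carrier
    signed Sign.+ x = x
    signed Sign.- x = - x

    signed-cong : ∀ s {x y} → x ≈ y → signed s x ≈ signed s y
    signed-cong Sign.+ x≈y = x≈y
    signed-cong Sign.- x≈y = -‿cong x≈y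

    signed-* : ∀ s t x y → signed (s Sign.* t) (x * y) ≈ signed s x * signed t y
    signed-* Sign.+ Sign.+ x y = refl
    signed-* Sign.+ Sign.- x y = -‿distribʳ-* x y
    signed-* Sign.- Sign.+ x y = -‿distribˡ-* x y
    signed-* Sign.- Sign.- x y = begin
      x * y         ≈⟨ -‿involutive (x * y) ⟨
      - - (x * y)   ≈⟨ -‿cong (-‿distribˡ-* x y) ⟩
      - (- x * y)   ≈⟨ -‿distribʳ-* (- x) y ⟩
      - x * - y     ∎

    ⟦◃⟧ : ∀ s n → ⟦ s ℤ.◃ n ⟧ℤ ≈ signed s (n · 1#)
    ⟦◃⟧ Sign.+ zero    = refl
    ⟦◃⟧ Sign.- zero    = sym -0#≈0#
    ⟦◃⟧ Sign.+ (suc n) = refl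
    ⟦◃⟧ Sign.- (suc n) = refl

    ⟦signAbs⟧ : ∀ i → ⟦ i ⟧ℤ ≈ signed (ℤ.sign i) (ℤ.∣ i ∣ · 1#)
    ⟦signAbs⟧ (+ n)      = refl
    ⟦signAbs⟧ -[1+ n ] = refl

    ⟦⊖⟧ : ∀ m n → ⟦ m ⊖ n ⟧ℤ ≈ m · 1# - n · 1#
    ⟦⊖⟧ m zero = sym (trans (+-congˡ -0#≈0#) (+-identityʳ _))
    ⟦⊖⟧ zero (suc n) = sym (+-identityˡ _)
    ⟦⊖⟧ (suc m) (suc n) = begin
      ⟦ suc m ⊖ suc n ⟧ℤ                      ≡⟨ ≡.cong ⟦_⟧ℤ (ℤ.[1+m]⊖[1+n]≡m⊖n m n) ⟩
      ⟦ m ⊖ n ⟧ℤ                              ≈⟨ ⟦⊖⟧ m n ⟩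
      x - y                                   ≈⟨ +-identityˡ (x - y) ⟨
      0# + (x - y)                            ≈⟨ +-congʳ (-‿inverseʳ 1#) ⟨
      (1# - 1#) + (x - y)                     ≈⟨ +-assoc 1# (- 1#) (x - y) ⟩
      1# + (- 1# + (x - y))                   ≈⟨ +-congˡ (+-assoc (- 1#) x (- y)) ⟨
      1# + ((- 1# + x) - y)                   ≈⟨ +-congˡ (+-congʳ (+-comm (- 1#) x)) ⟩
      1# + ((x - 1#) - y)                     ≈⟨ +-congˡ (+-assoc x (- 1#) (- y)) ⟩
      1# + (x + (- 1# - y))                   ≈⟨ +-assoc 1# x (- 1# - y) ⟨
      (1# + x) + (- 1# - y)                   ≈⟨ +-congˡ (⁻¹-∙-comm 1# y) ⟩
      (1# + x) - (1# + y)                     ≈⟨ +-cong (1+× m 1#) (-‿cong (1+× n 1#)) ⟨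
      suc m · 1# - suc n · 1#                 ∎
      where x = m · 1#; y = n · 1#

  +-homo : ∀ i j → ⟦ i ℤ.+ j ⟧ℤ ≈ ⟦ i ⟧ℤ + ⟦ j ⟧ℤ
  +-homo (+ m)      (+ n)      = ×-homo-+ 1# m n
  +-homo (+ m)      -[1+ n ] = ⟦⊖⟧ m (suc n)
  +-homo -[1+ m ] (+ n)      = trans (⟦⊖⟧ n (suc m)) (+-comm _ _)
  +-homo -[1+ m ] -[1+ n ] = begin
    - (suc (suc (m ℕ.+ n)) · 1#)      ≡⟨ ≡.cong (λ k → - (k · 1#)) (ℕ.+-suc (suc m) n) ⟨
    - ((suc m ℕ.+ suc n) · 1#)        ≈⟨ -‿cong (×-homo-+ 1# (suc m) (suc n)) ⟩
    - (suc m · 1# + suc n · 1#)       ≈⟨ ⁻¹-∙-comm _ _ ⟨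
    - (suc m · 1#) + - (suc n · 1#)   ∎

  *-homo : ∀ i j → ⟦ i ℤ.* j ⟧ℤ ≈ ⟦ i ⟧ℤ * ⟦ j ⟧ℤ
  *-homo i j = begin
    ⟦ s ℤ.◃ (∣i∣ ℕ.* ∣j∣) ⟧ℤ                          ≈⟨ ⟦◃⟧ s (∣i∣ ℕ.* ∣j∣) ⟩
    signed s ((∣i∣ ℕ.* ∣j∣) · 1#)                     ≈⟨ signed-cong s (×1-homo-* ∣i∣ ∣j∣) ⟩
    signed s ((∣i∣ · 1#) * (∣j∣ · 1#))                ≈⟨ signed-* (ℤ.sign i) (ℤ.sign j) _ _ ⟩
    signed (ℤ.sign i) (∣i∣ · 1#) * signed (ℤ.sign j) (∣j∣ · 1#) ≈⟨ *-cong (⟦signAbs⟧ i) (⟦signAbs⟧ j) ⟨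
    ⟦ i ⟧ℤ * ⟦ j ⟧ℤ                                      ∎
    where s = ℤ.sign i Sign.* ℤ.sign j; ∣i∣ = ℤ.∣ i ∣; ∣j∣ = ℤ.∣ j ∣

  -‿homo : ∀ i → ⟦ ℤ.- i ⟧ℤ ≈ - ⟦ i ⟧ℤ
  -‿homo (+ zero)   = sym -0#≈0#
  -‿homo (+ suc n)  = refl
  -‿homo -[1+ n ] = sym (-‿involutive _)

  homomorphism : ℤ.+-*-rawRing ACR.-Raw-AlmostCommutative⟶ ACR.fromCommutativeRing R
  homomorphism = record
    { ⟦_⟧    = ⟦_⟧ℤ
    ; +-homo = +-homo
    ; *-homo = *-homo
    ; -‿homo = -‿homo
    ; 0-homo = refl
    ; 1-homo = refl
    }

  ⟦⟧ℤ-weaklyDec : ∀ i j → Maybe (⟦ i ⟧ℤ ≈ ⟦ j ⟧ℤ)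
  ⟦⟧ℤ-weaklyDec i j with i ℤ.≟ j
  ... | yes i≡j = just (reflexive (≡.cong ⟦_⟧ℤ i≡j))
  ... | no  _   = nothing

  open import Algebra.Solver.Ring ℤ.+-*-rawRing (ACR.fromCommutativeRing R)
                                  homomorphism ⟦⟧ℤ-weaklyDec public


module LinearAlgebra {c ℓ : Level} (R : CommutativeRing c ℓ) where
  open CommutativeRing R hiding (zero)
  open IntegerCoefficientSolver R using (solve; _:=_; _:+_; _:-_; _:*_; con)

  ∑ : {n : ℕ} → (Fin n → Carrier) → Carrier
  ∑ = sumF rawRing

  ∑-cong : ∀ {n} {f g : Fin n → Carrier} → (∀ t → f t ≈ g t) → ∑ f ≈ ∑ g
  ∑-cong {zero}  f≈g = refl
  ∑-cong {suc n} f≈g = +-cong (f≈g zero) (∑-cong (λ t → f≈g (suc t)))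

  ∑-distribʳ : ∀ {n} (f : Fin n → Carrier) x → ∑ (λ t → f t * x) ≈ ∑ f * x
  ∑-distribʳ {zero}  f x = sym (zeroˡ x)
  ∑-distribʳ {suc n} f x =
    trans (+-congˡ (∑-distribʳ (λ t → f (suc t)) x)) (sym (distribʳ x (f zero) _))

  ∑-sub-distribʳ : ∀ {n} (f g : Fin n → Carrier) x →
                   ∑ (λ t → f t - g t * x) ≈ ∑ f - ∑ g * x
  ∑-sub-distribʳ {zero}  f g x = solve 1 (λ x → con (+ 0) := con (+ 0) :- con (+ 0) :* x) refl x
  ∑-sub-distribʳ {suc n} f g x =
    trans (+-congˡ (∑-sub-distribʳ (λ t → f (suc t)) (λ t → g (suc t)) x))
          (solve 5 (λ a b c d x → (a :- b :* x) :+ (c :- d :* x) := (a :+ c) :- (b :+ d) :* x)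
                   refl (f zero) (g zero) _ _ x)

  ∑-punchIn : ∀ {n} (s : Fin (suc n)) (f : Fin (suc n) → Carrier) →
              ∑ f ≈ f s + ∑ (λ t → f (punchIn s t))
  ∑-punchIn zero f = refl
  ∑-punchIn {suc n} (suc s) f =
    trans (+-congˡ (∑-punchIn s (λ t → f (suc t))))
          (solve 3 (λ a b c → a :+ (b :+ c) := b :+ (a :+ c)) refl (f zero) (f (suc s)) _)

  pointGen₀⇒0≈1 : (u : Fin 0 → Carrier) → IsPointGen rawRing u → 0# ≈ 1#
  pointGen₀⇒0≈1 u (B , uB≈1) = uB≈1 zero zero

  pointGen₁-spans : (u w : Fin 1 → Carrier) → IsPointGen rawRing w →
                    InSpan rawRing {m = 1} (λ _ → w) u
  pointGen₁-spans u w (B , wB≈1) = (λ _ → u zero * B zero zero) , λ { zero → begin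
      u zero                                  ≈⟨ *-identityʳ _ ⟨
      u zero * 1#                             ≈⟨ *-congˡ (wB≈1 zero zero) ⟨
      u zero * (w zero * B zero zero + 0#)    ≈⟨ regroup (u zero) (w zero) (B zero zero) ⟩
      (u zero * B zero zero) * w zero + 0#    ∎ }
    where
    open import Relation.Binary.Reasoning.Setoid setoid
    regroup = solve 3 (λ u w b → u :* (w :* b :+ con (+ 0)) := (u :* b) :* w :+ con (+ 0)) refl

module Residue {c ℓ : Level} (R : CommutativeRing c ℓ)
               {M : Pred (CommutativeRing.Carrier R) ℓ} (M-ideal : IsIdeal R M) where
  open CommutativeRing R hiding (zero)
  open IsIdeal M-ideal
  open LinearAlgebra R
  open import Algebra.Properties.Ring ring using (-1*x≈-x)

  ≈⇒∈M : ∀ {x y} → x ≈ y → M (x - y)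
  ≈⇒∈M {x} {y} x≈y = resp (sym (trans (+-congʳ x≈y) (-‿inverseʳ y))) zero∈

  -‿∈ : ∀ {x} → M x → M (- x)
  -‿∈ {x} x∈M = resp (-1*x≈-x x) (*∈ (- 1#) x∈M)

  ∑∈ : ∀ {n} (f : Fin n → Carrier) → (∀ t → M (f t)) → M (∑ f)
  ∑∈ {zero}  f f∈M = zero∈
  ∑∈ {suc n} f f∈M = +∈ (f∈M zero) (∑∈ (λ t → f (suc t)) (λ t → f∈M (suc t)))

  ∑ᴹ≡∑ : ∀ {n} (f : Fin n → Carrier) → sumF (residue R M) f ≡ ∑ f
  ∑ᴹ≡∑ {zero}  f = ≡.refl
  ∑ᴹ≡∑ {suc n} f = ≡.cong (_+_ (f zero)) (∑ᴹ≡∑ (λ t → f (suc t)))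

  δᴹ≡δ : ∀ {m} (i k : Fin m) → δ (residue R M) i k ≡ δ rawRing i k
  δᴹ≡δ i k with i ≟ k
  ... | yes _ = ≡.refl
  ... | no  _ = ≡.refl

  SpansModulo : ∀ {m n} → (Fin m → Fin n → Carrier) → Set (c ⊔ ℓ)
  SpansModulo {m} {n} V =
    ∀ (x : Fin n → Carrier) → Σ (Fin m → Carrier) λ a → ∀ j → M (x j - ∑ (λ t → a t * V t j))

  residue-spansModulo : ∀ {m n} (V : Fin m → Fin n → Carrier) →
                        SpansAll (residue R M) V → SpansModulo V
  residue-spansModulo V spans x =
    a , λ j → ≡.subst (λ y → M (x j - y)) (∑ᴹ≡∑ (λ t → a t * V t j)) (x≈aV j)
    where a = proj₁ (spans x); x≈aV = proj₂ (spans x)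

  unimodular⇒residue : ∀ {m n} (V : Fin m → Fin n → Carrier) →
                       Unimodular rawRing V → Unimodular (residue R M) V
  unimodular⇒residue V (B , VB≈I) = B , λ i k →
    ≡.subst₂ (λ x y → M (x - y)) (≡.sym (∑ᴹ≡∑ (λ j → V i j * B j k))) (≡.sym (δᴹ≡δ i k))
             (≈⇒∈M (VB≈I i k))

  inSpan⇒residue : ∀ {m n} (V : Fin m → Fin n → Carrier) x →
                   InSpan rawRing V x → InSpan (residue R M) V x
  inSpan⇒residue V x (a , x≈aV) =
    a , λ j → ≡.subst (λ y → M (x j - y)) (≡.sym (∑ᴹ≡∑ (λ t → a t * V t j))) (≈⇒∈M (x≈aV j))

  spansAll⇒residue : ∀ {m n} (V : Fin m → Fin n → Carrier) →
                     SpansAll rawRing V → SpansAll (residue R M) V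
  spansAll⇒residue V spans x = inSpan⇒residue V x (spans x)

  samePoint⇒residue : ∀ {n} (u w : Fin n → Carrier) →
                      SamePoint rawRing u w → SamePoint (residue R M) u w
  samePoint⇒residue u w (u∈Rw , w∈Ru) =
    inSpan⇒residue (λ _ → w) u u∈Rw , inSpan⇒residue (λ _ → u) w w∈Ru

-- M ∪ {x ∣ Q} is an ideal containing M, so by maximality it is M (and ¬ Q) or it contains 1 (and Q).
maximalIdeal⇒decidable : {c ℓ : Level} (R : CommutativeRing c ℓ)
                         {M : Pred (CommutativeRing.Carrier R) ℓ} →
                         IsMaximalIdeal R M → (Q : Set ℓ) → Dec Q
maximalIdeal⇒decidable R {M} (M-ideal , 1∉M , maximal) Q
  with maximal (λ x → M x ⊎ Q) M∪Q-ideal inj₁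
  where
  open IsIdeal M-ideal
  M∪Q-ideal : IsIdeal R (λ x → M x ⊎ Q)
  M∪Q-ideal = record
    { resp  = λ { x≈y (inj₁ x∈M) → inj₁ (resp x≈y x∈M) ; _ (inj₂ q) → inj₂ q }
    ; zero∈ = inj₁ zero∈
    ; +∈    = λ { (inj₁ x∈M) (inj₁ y∈M) → inj₁ (+∈ x∈M y∈M) ; (inj₂ q) _ → inj₂ q ; _ (inj₂ q) → inj₂ q }
    ; *∈    = λ { r (inj₁ x∈M) → inj₁ (*∈ r x∈M) ; r (inj₂ q) → inj₂ q }
    }
... | inj₁ M∪Q⊆M         = no λ q → 1∉M (M∪Q⊆M (inj₂ q))
... | inj₂ (inj₁ 1∈M)    = ⊥-elim (1∉M 1∈M)
... | inj₂ (inj₂ q)      = yes q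

module FiniteRing {c ℓ : Level} (R : CommutativeRing c ℓ) (finite : Finite R)
                  (decide : (Q : Set ℓ) → Dec Q) where
  open CommutativeRing R hiding (zero)
  open IntegerCoefficientSolver R using (solve; _:=_; _:+_; _:-_; _:*_; con)

  elements : List Carrier
  elements = proj₁ finite

  element : Fin (length elements) → Carrier
  element = lookup elements

  index : Carrier → Fin (length elements)
  index x = Any.index (proj₂ finite x)

  element-index : ∀ x → x ≈ element (index x)
  element-index x = lookup-index (proj₂ finite x)

  -- I + R y, with the coefficient drawn from the enumeration so that the predicate stays at level ℓ.
  _⊕_ : Pred Carrier ℓ → Carrier → Pred Carrier ℓ
  (I ⊕ y) z = Σ (Fin (length elements)) λ k → I (z - element k * y)

  zeroIdeal : IsIdeal R (_≈ 0#)
  zeroIdeal = record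
    { resp  = λ x≈y x≈0 → trans (sym x≈y) x≈0
    ; zero∈ = refl
    ; +∈    = λ x≈0 y≈0 → trans (+-cong x≈0 y≈0) (+-identityʳ 0#)
    ; *∈    = λ r x≈0 → trans (*-congˡ x≈0) (zeroʳ r)
    }

  module _ {I : Pred Carrier ℓ} (I-ideal : IsIdeal R I) (y : Carrier) where
    open IsIdeal I-ideal

    private
      coefficient-cong : ∀ {z a b} → a ≈ b → z - a * y ≈ z - b * y
      coefficient-cong a≈b = +-congˡ (-‿cong (*-congʳ a≈b))

    ⊕-ideal : IsIdeal R (I ⊕ y)
    ⊕-ideal = record
      { resp  = λ { x≈z (k , h) → k , resp (+-congʳ x≈z) h }
      ; zero∈ = index 0# , resp
          (trans (solve 1 (λ y → con (+ 0) := con (+ 0) :- con (+ 0) :* y) refl y)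
                 (coefficient-cong (element-index 0#)))
          zero∈
      ; +∈    = λ { {z} {z′} (k , h) (k′ , h′) → index (element k + element k′) , resp
          (trans (solve 5 (λ z z′ a b y → (z :- a :* y) :+ (z′ :- b :* y) := (z :+ z′) :- (a :+ b) :* y)
                          refl z z′ (element k) (element k′) y)
                 (coefficient-cong (element-index _)))
          (+∈ h h′) }
      ; *∈    = λ { r {z} (k , h) → index (r * element k) , resp
          (trans (solve 4 (λ r z a y → r :* (z :- a :* y) := r :* z :- (r :* a) :* y)
                          refl r z (element k) y)
                 (coefficient-cong (element-index _)))
          (*∈ r h) }
      }

    ⊆⊕ : I ⊆ I ⊕ y
    ⊆⊕ {z} z∈I = index 0# , resp
      (trans (solve 2 (λ z y → z := z :- con (+ 0) :* y) refl z y) (coefficient-cong (element-index 0#)))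
      z∈I

    ∈⊕ : (I ⊕ y) y
    ∈⊕ = index 1# , resp
      (trans (solve 1 (λ y → con (+ 0) := y :- con (+ 1) :* y) refl y)
             (coefficient-cong (element-index 1#)))
      zero∈

  -- Run through the enumeration, adjoining each element unless that makes the ideal improper;
  -- every element finally left out was rejected because adjoining it produces 1.
  module Greedy {I : Pred Carrier ℓ} (I-ideal : IsIdeal R I) (1∉I : ¬ I 1#) where

    grow : List Carrier → Pred Carrier ℓ
    grow []       = I
    grow (y ∷ ys) with decide ((grow ys ⊕ y) 1#)
    ... | yes _ = grow ys
    ... | no  _ = grow ys ⊕ y

    grow-ideal : ∀ ys → IsIdeal R (grow ys)
    grow-ideal []       = I-ideal
    grow-ideal (y ∷ ys) with decide ((grow ys ⊕ y) 1#)
    ... | yes _ = grow-ideal ys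
    ... | no  _ = ⊕-ideal (grow-ideal ys) y

    1∉grow : ∀ ys → ¬ grow ys 1#
    1∉grow []       = 1∉I
    1∉grow (y ∷ ys) with decide ((grow ys ⊕ y) 1#)
    ... | yes _   = 1∉grow ys
    ... | no  1∉J = 1∉J

    grow-step : ∀ y ys → grow ys ⊆ grow (y ∷ ys)
    grow-step y ys with decide ((grow ys ⊕ y) 1#)
    ... | yes _ = λ z∈J → z∈J
    ... | no  _ = ⊆⊕ (grow-ideal ys) y

    I⊆grow : ∀ ys → I ⊆ grow ys
    I⊆grow []       z∈I = z∈I
    I⊆grow (y ∷ ys) z∈I = grow-step y ys (I⊆grow ys z∈I)

    left-out⇒improper : ∀ ys {K : Pred Carrier ℓ} → IsIdeal R K → grow ys ⊆ K →
                        (p : Fin (length ys)) → K (lookup ys p) → ¬ grow ys (lookup ys p) → K 1#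
    left-out⇒improper (y ∷ ys) K-ideal J⊆K zero y∈K y∉J with decide ((grow ys ⊕ y) 1#)
    ... | yes (k , 1-ky∈J) =
      resp (solve 3 (λ o a y → (o :- a :* y) :+ a :* y := o) refl 1# (element k) y)
           (+∈ (J⊆K 1-ky∈J) (*∈ (element k) y∈K))
      where open IsIdeal K-ideal
    ... | no  _            = ⊥-elim (y∉J (∈⊕ (grow-ideal ys) y))
    left-out⇒improper (y ∷ ys) K-ideal J⊆K (suc p) y∈K y∉J =
      left-out⇒improper ys K-ideal (λ z∈J → J⊆K (grow-step y ys z∈J)) p y∈K
                        (λ y∈J → y∉J (grow-step y ys y∈J))

    grow-maximal : IsMaximalIdeal R (grow elements)
    grow-maximal = grow-ideal elements , 1∉grow elements , maximal
      where
      J = grow elements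
      maximal : ∀ K → IsIdeal R K → J ⊆ K → K ⊆ J ⊎ K 1#
      maximal K K-ideal J⊆K with decide (Σ (Fin (length elements)) λ k → K (element k) × ¬ J (element k))
      ... | yes (k , k∈K , k∉J) = inj₂ (left-out⇒improper elements K-ideal J⊆K k k∈K k∉J)
      ... | no  K⊆J             = inj₁ λ {z} z∈K →
        IsIdeal.resp (grow-ideal elements) (sym (element-index z))
          (decidable-stable (decide _) λ z∉J →
             K⊆J (index z , IsIdeal.resp K-ideal (element-index z) z∈K , z∉J))

  properIdeal⊆maximal : ∀ {I : Pred Carrier ℓ} → IsIdeal R I → ¬ I 1# →
                        Σ (Pred Carrier ℓ) λ J → IsMaximalIdeal R J × I ⊆ J
  properIdeal⊆maximal I-ideal 1∉I = grow elements , grow-maximal , I⊆grow elements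
    where open Greedy I-ideal 1∉I

  nonunit∈maximal : ∀ x → ¬ (Σ (Fin (length elements)) λ k → x * element k ≈ 1#) →
                    Σ (Pred Carrier ℓ) λ J → IsMaximalIdeal R J × J x
  nonunit∈maximal x nonunit =
    let (J , J-maximal , Rx⊆J) = properIdeal⊆maximal (⊕-ideal zeroIdeal x) 1∉Rx
    in J , J-maximal , Rx⊆J (∈⊕ zeroIdeal x)
    where
    1∉Rx : ¬ (_⊕_ (_≈ 0#) x 1#)
    1∉Rx (k , 1-kx≈0) = nonunit (k , trans
      (solve 2 (λ x a → x :* a := con (+ 1) :- (con (+ 1) :- a :* x)) refl x (element k))
      (trans (+-congˡ (-‿cong 1-kx≈0)) (solve 0 (con (+ 1) :- con (+ 0) := con (+ 1)) refl)))

extendInjection : ∀ {n k} → Fin (suc k) → (Fin n → Fin k) → Fin (suc n) → Fin (suc k)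
extendInjection c τ zero    = c
extendInjection c τ (suc t) = punchIn c (τ t)

extendInjection-injective : ∀ {n k} (c : Fin (suc k)) (τ : Fin n → Fin k) →
                            Injective _≡_ _≡_ τ → Injective _≡_ _≡_ (extendInjection c τ)
extendInjection-injective c τ τ-inj {zero}  {zero}   _  = ≡.refl
extendInjection-injective c τ τ-inj {zero}  {suc t}  eq = ⊥-elim (Fin.punchInᵢ≢i c (τ t) (≡.sym eq))
extendInjection-injective c τ τ-inj {suc t} {zero}   eq = ⊥-elim (Fin.punchInᵢ≢i c (τ t) eq)
extendInjection-injective c τ τ-inj {suc t} {suc t′} eq =
  ≡.cong suc (τ-inj (Fin.punchIn-injective c (τ t) (τ t′) eq))

module FiniteLocalRing {c ℓ : Level} (R : CommutativeRing c ℓ)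
                       {M : Pred (CommutativeRing.Carrier R) ℓ}
                       (finite : Finite R) (local : IsLocalWith R M) where
  open CommutativeRing R hiding (zero)
  open IntegerCoefficientSolver R using (solve; _:=_; _:+_; _:-_; _:*_; :-_; con)
  open LinearAlgebra R
  open Residue R (proj₁ (proj₁ local))
  open IsIdeal (proj₁ (proj₁ local))
  open import Relation.Binary.Reasoning.Setoid setoid

  1∉M : ¬ M 1#
  1∉M = proj₁ (proj₂ (proj₁ local))

  0≉1 : ¬ 0# ≈ 1#
  0≉1 0≈1 = 1∉M (resp 0≈1 zero∈)

  decide : (Q : Set ℓ) → Dec Q
  decide = maximalIdeal⇒decidable R (proj₁ local)

  open FiniteRing R finite decide using (element; nonunit∈maximal)

  ∉M⇒unit : ∀ {x} → ¬ M x → Σ Carrier λ w → x * w ≈ 1#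
  ∉M⇒unit {x} x∉M with decide (Σ _ λ k → x * element k ≈ 1#)
  ... | yes (k , xk≈1) = element k , xk≈1
  ... | no  nonunit    =
    let (J , J-maximal , x∈J) = nonunit∈maximal x nonunit
    in ⊥-elim (x∉M (proj₁ (proj₂ local J J-maximal) x∈J))

  pointGen⇐residue : ∀ {n} (u : Fin n → Carrier) → IsPointGen (residue R M) u → IsPointGen rawRing u
  pointGen⇐residue u (B , uB≈1) = (λ j _ → B j zero * w) , λ { zero zero → begin
      ∑ (λ j → u j * (B j zero * w))   ≈⟨ ∑-cong (λ j → *-assoc (u j) (B j zero) w) ⟨
      ∑ (λ j → (u j * B j zero) * w)   ≈⟨ ∑-distribʳ (λ j → u j * B j zero) w ⟩
      s * w                            ≈⟨ sw≈1 ⟩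
      1#                               ∎ }
    where
    s = ∑ (λ j → u j * B j zero)
    s-1∈M : M (s - 1#)
    s-1∈M = ≡.subst (λ x → M (x - 1#)) (∑ᴹ≡∑ (λ j → u j * B j zero)) (uB≈1 zero zero)
    s∉M : ¬ M s
    s∉M s∈M = 1∉M (resp (solve 2 (λ s o → s :+ :- (s :- o) := o) refl s 1#) (+∈ s∈M (-‿∈ s-1∈M)))
    w = proj₁ (∉M⇒unit s∉M)
    sw≈1 = proj₂ (∉M⇒unit s∉M)

  -- One step of Gaussian elimination: clear the first column using the pivot row s,
  -- whose first entry is a unit.
  module Pivot {m n : ℕ} (V : Fin (suc m) → Fin (suc n) → Carrier) (s : Fin (suc m))
               (pivot∉M : ¬ M (V s zero)) where
    private
      u : Carrier
      u = V s zero
      w : Carrier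
      w = proj₁ (∉M⇒unit pivot∉M)
      uw≈1 : u * w ≈ 1#
      uw≈1 = proj₂ (∉M⇒unit pivot∉M)

      row : Fin m → Fin (suc n) → Carrier
      row t = V (punchIn s t)

      ratio : Fin m → Carrier
      ratio t = row t zero * w

      ∑ratio : (Fin m → Carrier) → Carrier
      ∑ratio b = ∑ (λ t → b t * ratio t)

    cleared : Fin m → Fin n → Carrier
    cleared t j = row t (suc j) - ratio t * V s (suc j)

    private
      combination-split : ∀ (a : Fin (suc m) → Carrier) j →
                          ∑ (λ T → a T * V T j) ≈ a s * V s j + ∑ (λ t → a (punchIn s t) * row t j)
      combination-split a j = ∑-punchIn s (λ T → a T * V T j)

      combination-column₀ : ∀ (b : Fin m → Carrier) → ∑ (λ t → b t * row t zero) ≈ ∑ratio b * u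
      combination-column₀ b = trans (∑-cong λ t → begin
          b t * row t zero               ≈⟨ *-congˡ (*-identityʳ _) ⟨
          b t * (row t zero * 1#)        ≈⟨ *-congˡ (*-congˡ uw≈1) ⟨
          b t * (row t zero * (u * w))   ≈⟨ regroup (b t) (row t zero) u w ⟩
          (b t * ratio t) * u            ∎)
        (∑-distribʳ (λ t → b t * ratio t) u)
        where regroup = solve 4 (λ b r u w → b :* (r :* (u :* w)) := (b :* (r :* w)) :* u) refl

      combination-cleared : ∀ (b : Fin m → Carrier) j → ∑ (λ t → b t * cleared t j)
                                    ≈ ∑ (λ t → b t * row t (suc j)) - ∑ratio b * V s (suc j)
      combination-cleared b j = trans
        (∑-cong λ t → solve 4 (λ b x r y → b :* (x :- r :* y) := b :* x :- (b :* r) :* y)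
                              refl (b t) (row t (suc j)) (ratio t) (V s (suc j)))
        (∑-sub-distribʳ (λ t → b t * row t (suc j)) (λ t → b t * ratio t) (V s (suc j)))

    -- Reach (0, y) modulo M with coefficients a. Column 0 then gives β u ∈ M, so β ∈ M, and this
    -- is exactly the error made by combining the cleared rows with the remaining coefficients.
    cleared-spansModulo : SpansModulo V → SpansModulo cleared
    cleared-spansModulo spans y = b , λ j →
      resp (sym (residual j)) (+∈ (x≈aV-split j) (*∈ (V s (suc j)) β∈M))
      where
      x : Fin (suc n) → Carrier
      x zero    = 0#
      x (suc j) = y j
      a = proj₁ (spans x)
      b = λ t → a (punchIn s t)
      β = a s + ∑ratio b
      x≈aV-split : ∀ j → M (x (suc j) - (a s * V s (suc j) + ∑ (λ t → b t * row t (suc j))))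
      x≈aV-split j = resp (+-congˡ (-‿cong (combination-split a (suc j)))) (proj₂ (spans x) (suc j))
      βu∈M : M (β * u)
      βu∈M = resp (begin
          - (0# - ∑ (λ T → a T * V T zero))
            ≈⟨ -‿cong (+-congˡ (-‿cong (combination-split a zero))) ⟩
          - (0# - (a s * u + ∑ (λ t → b t * row t zero)))
            ≈⟨ -‿cong (+-congˡ (-‿cong (+-congˡ (combination-column₀ b)))) ⟩
          - (0# - (a s * u + ∑ratio b * u))
            ≈⟨ regroup (a s) (∑ratio b) u ⟩
          β * u
            ∎)
        (-‿∈ (proj₂ (spans x) zero))
        where regroup = solve 3 (λ a q u → :- (con (+ 0) :- (a :* u :+ q :* u)) := (a :+ q) :* u) refl
      β∈M : M β
      β∈M = resp (trans (solve 3 (λ w b u → w :* (b :* u) := b :* (u :* w)) refl w β u)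
                        (trans (*-congˡ uw≈1) (*-identityʳ β)))
                 (*∈ w βu∈M)
      residual : ∀ j → y j - ∑ (λ t → b t * cleared t j)
                       ≈ (y j - (a s * V s (suc j) + ∑ (λ t → b t * row t (suc j)))) + V s (suc j) * β
      residual j = trans (+-congˡ (-‿cong (combination-cleared b j)))
        (solve 5 (λ y a v P q → y :- (P :- q :* v) := (y :- (a :* v :+ P)) :+ v :* (a :+ q))
               refl (y j) (a s) (V s (suc j)) (∑ (λ t → b t * row t (suc j))) (∑ratio b))

    cleared-spans⇒spans : SpansAll rawRing cleared → SpansAll rawRing V
    cleared-spans⇒spans spans x = a , x≈aV
      where
      α = x zero * w
      y : Fin n → Carrier
      y j = x (suc j) - α * V s (suc j)
      b = proj₁ (spans y)
      a = insertAt b s (α - ∑ratio b)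
      a-split : ∀ j → ∑ (λ T → a T * V T j) ≈ (α - ∑ratio b) * V s j + ∑ (λ t → b t * row t j)
      a-split j = trans (combination-split a j)
        (+-cong (*-congʳ (reflexive (insertAt-lookup b s _)))
                (∑-cong λ t → *-congʳ (reflexive (insertAt-punchIn b s _ t))))
      x≈aV : ∀ j → x j ≈ ∑ (λ T → a T * V T j)
      x≈aV zero = sym (begin
        ∑ (λ T → a T * V T zero)                          ≈⟨ a-split zero ⟩
        (α - ∑ratio b) * u + ∑ (λ t → b t * row t zero)   ≈⟨ +-congˡ (combination-column₀ b) ⟩
        (α - ∑ratio b) * u + ∑ratio b * u                 ≈⟨ regroup (x zero) w (∑ratio b) u ⟩
        x zero * (u * w)                                  ≈⟨ *-congˡ uw≈1 ⟩
        x zero * 1#                                       ≈⟨ *-identityʳ _ ⟩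
        x zero                                            ∎)
        where regroup = solve 4 (λ x w q u → (x :* w :- q) :* u :+ q :* u := x :* (u :* w)) refl
      x≈aV (suc j) = begin
        x (suc j)                               ≈⟨ regroup₁ (x (suc j)) α v ⟩
        y j + α * v                             ≈⟨ +-congʳ (proj₂ (spans y) j) ⟩
        ∑ (λ t → b t * cleared t j) + α * v     ≈⟨ +-congʳ (combination-cleared b j) ⟩
        (P - ∑ratio b * v) + α * v              ≈⟨ regroup₂ P (∑ratio b) v α ⟩
        (α - ∑ratio b) * v + P                  ≈⟨ a-split (suc j) ⟨
        ∑ (λ T → a T * V T (suc j))             ∎
        where
        v = V s (suc j)
        P = ∑ (λ t → b t * row t (suc j))
        regroup₁ = solve 3 (λ x a v → x := (x :- a :* v) :+ a :* v) refl
        regroup₂ = solve 4 (λ P q v a → (P :- q :* v) :+ a :* v := (a :- q) :* v :+ P) refl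

  pivot-exists : ∀ {m n} (V : Fin m → Fin (suc n) → Carrier) → SpansModulo V →
                 Σ (Fin m) λ s → ¬ M (V s zero)
  pivot-exists {n = n} V spans with decide (Σ _ λ s → ¬ M (V s zero))
  ... | yes pivot = pivot
  ... | no  none  = ⊥-elim (1∉M (resp (solve 2 (λ o S → (o :- S) :+ S := o) refl 1# _)
                                     (+∈ (proj₂ (spans e₀) zero) (∑∈ _ λ t → *∈ _ (column₀∈M t)))))
    where
    e₀ : Fin (suc n) → Carrier
    e₀ zero    = 1#
    e₀ (suc _) = 0#
    column₀∈M : ∀ t → M (V t zero)
    column₀∈M t = decidable-stable (decide _) λ t∉M → none (t , t∉M)

  spansModulo⇒spans : ∀ {m n} (V : Fin m → Fin n → Carrier) → SpansModulo V →
                      n ≤ m × SpansAll rawRing V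
  spansModulo⇒spans {n = zero}  V spans = z≤n , λ x → (λ _ → 0#) , λ ()
  spansModulo⇒spans {m} {suc n} V spans with pivot-exists V spans
  spansModulo⇒spans {suc m} {suc n} V spans | s , s∉M =
    let (n≤m , cleared-spans) = spansModulo⇒spans cleared (cleared-spansModulo spans)
    in s≤s n≤m , cleared-spans⇒spans cleared-spans
    where open Pivot V s s∉M

  -- If q a and q b gave the same point of (R/M)^(n+2), then in an (n+2)-family through a and b the
  -- vector q a could be dropped, leaving n+1 vectors that span (R/M)^(n+2).
  residue-distinct : ∀ {n k} (q : Fin k → Fin (suc (suc n)) → Carrier) → suc (suc n) ≤ k →
                     (∀ (σ : Fin (suc (suc n)) → Fin k) → Injective _≡_ _≡_ σ →
                        SpansAll (residue R M) (λ t → q (σ t))) →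
                     ∀ a b → a ≢ b → ¬ SamePoint (residue R M) (q a) (q b)
  residue-distinct {n} {suc (suc k)} q (s≤s (s≤s n≤k)) spans a b a≢b ((cf , qa≈cqb) , _) =
    ℕ.n≮n (suc n) (proj₁ (spansModulo⇒spans W W-spans))
    where
    τ : Fin (suc n) → Fin (suc k)
    τ = extendInjection (punchOut a≢b) (λ t → inject≤ t n≤k)
    σ : Fin (suc (suc n)) → Fin (suc (suc k))
    σ = extendInjection a τ
    σ-injective : Injective _≡_ _≡_ σ
    σ-injective = extendInjection-injective a τ
      (extendInjection-injective _ _ λ eq → Fin.inject≤-injective n≤k n≤k _ _ eq)
    V : Fin (suc (suc n)) → Fin (suc (suc n)) → Carrier
    V t = q (σ t)
    W : Fin (suc n) → Fin (suc (suc n)) → Carrier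
    W t = V (suc t)
    V₀≈cV₁ : ∀ j → M (V zero j - (cf zero * V (suc zero) j + 0#))
    V₀≈cV₁ = ≡.subst (λ z → ∀ j → M (q a j - (cf zero * q z j + 0#)))
                     (≡.sym (Fin.punchIn-punchOut a≢b)) qa≈cqb
    W-spans : SpansModulo W
    W-spans x = b′ , λ j → resp
      (solve 7 (λ x a₀ a₁ v₀ v₁ c S →
                  (x :- (a₀ :* v₀ :+ (a₁ :* v₁ :+ S))) :+ a₀ :* (v₀ :- (c :* v₁ :+ con (+ 0)))
                  := x :- ((a₁ :+ a₀ :* c) :* v₁ :+ S))
             refl (x j) (a′ zero) (a′ (suc zero)) (V zero j) (V (suc zero) j) (cf zero)
             (∑ (λ t → a′ (suc (suc t)) * V (suc (suc t)) j)))
      (+∈ (x≈a′V j) (*∈ (a′ zero) (V₀≈cV₁ j)))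
      where
      V-spans : SpansModulo V
      V-spans = residue-spansModulo V (spans σ σ-injective)
      a′ : Fin (suc (suc n)) → Carrier
      a′ = proj₁ (V-spans x)
      x≈a′V : ∀ j → M (x j - ∑ (λ t → a′ t * V t j))
      x≈a′V = proj₂ (V-spans x)
      b′ : Fin (suc n) → Carrier
      b′ zero    = a′ (suc zero) + a′ zero * cf zero
      b′ (suc t) = a′ (suc (suc t))

restrictArc : ∀ {c ℓ} (S : RawRing c ℓ) {n k k′} (p : Fin k → Fin n → RawRing.Carrier S) →
              IsArc S n k p → n < k′ → (k′≤k : k′ ≤ k) → IsArc S n k′ (λ t → p (inject≤ t k′≤k))
restrictArc S p (_ , points , distinct , spans) n<k′ k′≤k =
    n<k′
  , (λ t → points (inject≤ t k′≤k))
  , (λ s t s≢t → distinct _ _ λ eq → s≢t (Fin.inject≤-injective k′≤k k′≤k s t eq))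
  , λ σ σ-inj → spans (λ t → inject≤ (σ t) k′≤k) λ eq → σ-inj (Fin.inject≤-injective k′≤k k′≤k _ _ eq)

minF≤ : ∀ {l} (f : Fin (suc l) → ℕ) i → minF f ≤ f i
minF≤ {zero}  f zero    = ℕ.≤-refl
minF≤ {suc l} f zero    = ℕ.m⊓n≤m _ _
minF≤ {suc l} f (suc i) = ℕ.≤-trans (ℕ.m⊓n≤n _ _) (minF≤ (λ j → f (suc j)) i)

≤minF : ∀ {l} (f : Fin (suc l) → ℕ) k → (∀ i → k ≤ f i) → k ≤ minF f
≤minF {zero}  f k k≤f = k≤f zero
≤minF {suc l} f k k≤f = ℕ.⊓-glb (k≤f zero) (≤minF (λ j → f (suc j)) k (λ j → k≤f (suc j)))

module Product {c ℓ : Level} {l : ℕ} (R : Fin l → CommutativeRing c ℓ) where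
  open RawRing (prodRing R) using (Carrier; _*_)
  module R i = CommutativeRing (R i)

  component : ∀ {m n} i → (Fin m → Fin n → Carrier) → Fin m → Fin n → R.Carrier i
  component i V t j = V t j i

  embed : ∀ i → R.Carrier i → Carrier
  embed i x i′ with i ≟ i′
  ... | yes ≡.refl = x
  ... | no  _      = R.0# i′

  embed-component : ∀ i x → embed i x i ≡ x
  embed-component i x with i ≟ i
  ... | yes ≡.refl = ≡.refl
  ... | no  i≢i    = ⊥-elim (i≢i ≡.refl)

  sumF-component : ∀ {m} (f : Fin m → Carrier) i →
                   sumF (prodRing R) f i ≡ sumF (R.rawRing i) (λ t → f t i)
  sumF-component {zero}  f i = ≡.refl
  sumF-component {suc m} f i = ≡.cong (R._+_ i (f zero i)) (sumF-component (λ t → f (suc t)) i)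

  δ-component : ∀ {m} (s t : Fin m) i → δ (prodRing R) s t i ≡ δ (R.rawRing i) s t
  δ-component s t i with s ≟ t
  ... | yes _ = ≡.refl
  ... | no  _ = ≡.refl

  unimodular-component : ∀ {m n} (V : Fin m → Fin n → Carrier) i →
                         Unimodular (prodRing R) V → Unimodular (R.rawRing i) (component i V)
  unimodular-component V i (B , VB≈I) = component i B , λ s t →
    ≡.subst₂ (R._≈_ i) (sumF-component (λ j → V s j * B j t) i) (δ-component s t i) (VB≈I s t i)

  unimodular-product : ∀ {m n} (V : Fin m → Fin n → Carrier) →
                       (∀ i → Unimodular (R.rawRing i) (component i V)) → Unimodular (prodRing R) V
  unimodular-product V unimodular = B , λ s t i →
    ≡.subst₂ (R._≈_ i) (≡.sym (sumF-component (λ j → V s j * B j t) i)) (≡.sym (δ-component s t i))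
             (proj₂ (unimodular i) s t)
    where B = λ j t i → proj₁ (unimodular i) j t

  inSpan-component : ∀ {m n} (V : Fin m → Fin n → Carrier) x i →
                     InSpan (prodRing R) V x → InSpan (R.rawRing i) (component i V) (λ j → x j i)
  inSpan-component V x i (a , x≈aV) = (λ t → a t i) , λ j →
    ≡.subst (R._≈_ i (x j i)) (sumF-component (λ t → a t * V t j) i) (x≈aV j i)

  inSpan-product : ∀ {m n} (V : Fin m → Fin n → Carrier) x →
                   (∀ i → InSpan (R.rawRing i) (component i V) (λ j → x j i)) → InSpan (prodRing R) V x
  inSpan-product V x inSpan = a , λ j i →
    ≡.subst (R._≈_ i (x j i)) (≡.sym (sumF-component (λ t → a t * V t j) i)) (proj₂ (inSpan i) j)
    where a = λ t i → proj₁ (inSpan i) t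

  samePoint-component : ∀ {n} (u w : Fin n → Carrier) i → SamePoint (prodRing R) u w →
                        SamePoint (R.rawRing i) (λ j → u j i) (λ j → w j i)
  samePoint-component u w i (u∈Rw , w∈Ru) =
    inSpan-component (λ _ → w) u i u∈Rw , inSpan-component (λ _ → u) w i w∈Ru

  spansAll-component : ∀ {m n} (V : Fin m → Fin n → Carrier) i →
                       SpansAll (prodRing R) V → SpansAll (R.rawRing i) (component i V)
  spansAll-component V i spans x = (λ t → a t i) , λ j →
    ≡.subst₂ (R._≈_ i) (embed-component i (x j)) (sumF-component (λ t → a t * V t j) i) (x≈aV j i)
    where a = proj₁ (spans (λ j → embed i (x j))); x≈aV = proj₂ (spans (λ j → embed i (x j)))

  spansAll-product : ∀ {m n} (V : Fin m → Fin n → Carrier) →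
                     (∀ i → SpansAll (R.rawRing i) (component i V)) → SpansAll (prodRing R) V
  spansAll-product V spans x = inSpan-product V x λ i → spans i (λ j → x j i)

module ProductOfFiniteLocalRings
  {c ℓ : Level} {l : ℕ} (R : Fin (suc l) → CommutativeRing c ℓ)
  (M : (i : Fin (suc l)) → Pred (CommutativeRing.Carrier (R i)) ℓ)
  (finite : ∀ i → Finite (R i)) (local : ∀ i → IsLocalWith (R i) (M i)) where
  open Product R
  open RawRing (prodRing R) using (Carrier)
  private
    module L i = FiniteLocalRing (R i) (finite i) (local i)
    module Res i = Residue (R i) (proj₁ (proj₁ (local i)))
    module LA i = LinearAlgebra (R i)

  arc⇒residueSpans : ∀ {n k} {p : Fin k → Fin n → Carrier} → IsArc (prodRing R) n k p →
                     ∀ i (σ : Fin n → Fin k) → Injective _≡_ _≡_ σ →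
                     SpansAll (residue (R i) (M i)) (λ t → component i p (σ t))
  arc⇒residueSpans (_ , _ , _ , spans) i σ σ-inj =
    Res.spansAll⇒residue i _ (spansAll-component _ i (spans σ σ-inj))

  -- For n ≤ 1 the arc itself is impossible: R⁰ has no points and any two points of R¹ coincide.
  arc⇒residueDistinct : ∀ {n k} {p : Fin k → Fin n → Carrier} → IsArc (prodRing R) n k p →
                        ∀ i a b → a ≢ b →
                        ¬ SamePoint (residue (R i) (M i)) (component i p a) (component i p b)
  arc⇒residueDistinct {zero} {p = p} (_ , points , _) i a _ _ _ =
    L.0≉1 i (LA.pointGen₀⇒0≈1 i (λ j → p a j i) (unimodular-component (λ _ → p a) i (points a)))
  arc⇒residueDistinct {suc zero} {p = p} (_ , points , distinct , _) i a b a≢b _ =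
    distinct a b a≢b (inSpan-point (p a) (p b) (points b) , inSpan-point (p b) (p a) (points a))
    where
    inSpan-point : ∀ u w → IsPointGen (prodRing R) w → InSpan (prodRing R) (λ _ → w) u
    inSpan-point u w w-point =
      inSpan-product (λ _ → w) u λ i →
        LA.pointGen₁-spans i (λ j → u j i) (λ j → w j i) (unimodular-component (λ _ → w) i w-point)
  arc⇒residueDistinct {suc (suc n)} arc@(n+2<k , _) i =
    L.residue-distinct i _ (ℕ.<⇒≤ n+2<k) (arc⇒residueSpans arc i)

  arc⇒residueArc : ∀ {n k} (p : Fin k → Fin n → Carrier) → IsArc (prodRing R) n k p →
                   ∀ i → IsArc (residue (R i) (M i)) n k (component i p)
  arc⇒residueArc p arc@(n<k , points , _) i =
      n<k
    , (λ t → Res.unimodular⇒residue i _ (unimodular-component _ i (points t)))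
    , arc⇒residueDistinct arc i
    , arc⇒residueSpans arc i

  residueArcs⇒arc : ∀ {n k} (q : ∀ i → Fin k → Fin n → CommutativeRing.Carrier (R i)) →
                    (∀ i → IsArc (residue (R i) (M i)) n k (q i)) →
                    IsArc (prodRing R) n k (λ t j i → q i t j)
  residueArcs⇒arc q arcs =
      proj₁ (arcs zero)
    , (λ t → unimodular-product _ λ i → L.pointGen⇐residue i _ (points i t))
    , (λ a b a≢b same → distinct zero a b a≢b
                          (Res.samePoint⇒residue zero _ _ (samePoint-component _ _ zero same)))
    , λ σ σ-inj → spansAll-product _ λ i →
        proj₂ (L.spansModulo⇒spans i _ (Res.residue-spansModulo i _ (spans i σ σ-inj)))
    where
    points   = λ i → proj₁ (proj₂ (arcs i))
    distinct = λ i → proj₁ (proj₂ (proj₂ (arcs i)))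
    spans    = λ i → proj₂ (proj₂ (proj₂ (arcs i)))

theorem6p2 : {c ℓ : Level} (l n : ℕ)
    (R : Fin (suc l) → CommutativeRing c ℓ)
    (M : (i : Fin (suc l)) → Pred (CommutativeRing.Carrier (R i)) ℓ)
    → (∀ i → Finite (R i))
    → (∀ i → IsLocalWith (R i) (M i))
    → (mres : Fin (suc l) → ℕ)
    → (∀ i → IsMaxArcSize (residue (R i) (M i)) n (mres i))
    → IsMaxArcSize (prodRing R) n (minF mres)
theorem6p2 l n R M finite local mres maximal =
    (_ , residueArcs⇒arc truncated λ i →
           restrictArc (residue (R i) (M i)) (proj₁ (arc i)) (proj₂ (arc i)) n<minF (minF≤ mres i))
  , λ k (p , p-arc) → ≤minF mres k λ i →
      proj₂ (maximal i) k (component i p , arc⇒residueArc p p-arc i)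
  where
  open ProductOfFiniteLocalRings R M finite local
  open Product R using (component)
  arc = λ i → proj₁ (maximal i)
  n<minF : n < minF mres
  n<minF = ≤minF mres (suc n) λ i → proj₁ (proj₂ (arc i))
  truncated : ∀ i → Fin (minF mres) → Fin n → CommutativeRing.Carrier (R i)
  truncated i t = proj₁ (arc i) (inject≤ t (minF≤ mres i))
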